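{- Let $q=2$. The plane orbits under $G_2$ are: the set of $\Gamma$-planes together with the $\overline{1_{\mathcal C}}$-planes (size $3+3=6$); the $2_{\mathcal C}$-planes (size $6$); the $3_{\mathcal C}$-planes (size $1$); the $0_{\mathcal C}$-planes (size $2$). The point orbits under $G_2$ are: the $\mathcal C$-points (size $3$); the T-points together with the $0_\Gamma$-points (size $6+2=8$); the $3_\Gamma$-points (size $1$); the $1_\Gamma$-points (size $3$).
   Context: Points of $\mathrm{PG}(3,2)$ are written $\mathbf{P}(x_0,x_1,x_2,x_3)$. For $t\in\mathbb{F}_2$ put $P(t)=\mathbf{P}(t^3,t^2,t,1)$, and $P(\infty)=\mathbf{P}(1,0,0,0)$. The twisted cubic is $\mathcal{C}=\{P(0),P(1),P(\infty)\}$. $G_2$ is the group of all projectivities of $\mathrm{PG}(3,2)$ mapping $\mathcal C$ to itself. The osculating plane at $P(t)$, $t\in\mathbb F_2$, is $x_0-3tx_1+3t^2x_2-t^3x_3=0$ and at $P(\infty)$ it is $x_3=0$; these are the $\Gamma$-planes. The tangent at $P(t)$, $t\in\mathbb F_2$, is the line through $P(t)$ and $\mathbf P(3t^2,2t,1,0)$; at $P(\infty)$ it is the line through $\mathbf P(1,0,0,0)$ and $\mathbf P(0,1,0,0)$. Plane types: $\Gamma$-plane; $\overline{1_{\mathcal C}}$-plane: a plane that is not a $\Gamma$-plane and contains exactly one point of $\mathcal C$; $d_{\mathcal C}$-plane ($d=0,2,3$): a plane containing exactly $d$ points of $\mathcal C$. Point types: $\mathcal C$-point: a point of $\mathcal C$;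 T-point: a point not on $\mathcal C$ lying on a tangent; $\mu_\Gamma$-point ($\mu\in\{0,1,3\}$): a point not on $\mathcal C$ and on no tangent, lying on exactly $\mu$ $\Gamma$-planes. -}

module Defs where

open import Data.Nat using (ℕ)
open import Data.Vec using (Vec; []; _∷_; map; transpose; foldr; zipWith)
open import Data.List using (List; length)
open import Data.List.Membership.Propositional using (_∈_)
open import Data.List.Relation.Unary.Unique.Propositional using (Unique)
open import Data.Product using (Σ; _×_; ∃)
open import Data.Sum using (_⊎_)
open import Relation.Nullary using (¬_)
open import Relation.Binary.PropositionalEquality using (_≡_)

data F2 : Set where
  𝟎 𝟏 : F2

infixl 6 _+_
infixl 7 _*_

_+_ : F2 → F2 → F2
𝟎 + y = y
𝟏 + 𝟎 = 𝟏
𝟏 + 𝟏 = 𝟎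

_*_ : F2 → F2 → F2
𝟎 * y = 𝟎
𝟏 * y = y

-_ : F2 → F2
- x = x

three two : F2
three = 𝟏 + 𝟏 + 𝟏
two = 𝟏 + 𝟏

V4 : Set
V4 = Vec F2 4

zero4 : V4
zero4 = 𝟎 ∷ 𝟎 ∷ 𝟎 ∷ 𝟎 ∷ []

_⊕_ : V4 → V4 → V4
u ⊕ w = zipWith _+_ u w

_·_ : F2 → V4 → V4
c · u = map (c *_) u

dot : ∀ {n} → Vec F2 n → Vec F2 n → F2
dot u v = foldr (λ _ → F2) _+_ 𝟎 (zipWith _*_ u v)

-- 4×4 matrices, as a vector of rows; acting on column vectors
Mat : Set
Mat = Vec V4 4

apply : Mat → V4 → V4
apply M v = map (λ r → dot r v) M

_⊗_ : Mat → Mat → Mat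
M ⊗ N = map (λ r → map (λ c → dot r c) (transpose N)) M

I4 : Mat
I4 = (𝟏 ∷ 𝟎 ∷ 𝟎 ∷ 𝟎 ∷ []) ∷ (𝟎 ∷ 𝟏 ∷ 𝟎 ∷ 𝟎 ∷ []) ∷
     (𝟎 ∷ 𝟎 ∷ 𝟏 ∷ 𝟎 ∷ []) ∷ (𝟎 ∷ 𝟎 ∷ 𝟎 ∷ 𝟏 ∷ []) ∷ []

Invertible : Mat → Set
Invertible M = Σ Mat λ N → (M ⊗ N ≡ I4) × (N ⊗ M ≡ I4)

-- PG(3,2): over F_2 every projective point has a unique nonzero
-- representative, so points (and planes, via dual coordinates) are the
-- nonzero vectors of F_2^4.  Projectivities are induced by invertible
-- matrices (PGL(4,2) = GL(4,2)).

IsPoint : V4 → Set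
IsPoint v = ¬ (v ≡ zero4)

IsPlane : V4 → Set
IsPlane a = ¬ (a ≡ zero4)

On : V4 → V4 → Set
On a v = dot a v ≡ 𝟎

MapsPlane : Mat → V4 → V4 → Set
MapsPlane g a b = ∀ v → IsPoint v → (On a v → On b (apply g v)) × (On b (apply g v) → On a v)

MapsPoint : Mat → V4 → V4 → Set
MapsPoint g v w = apply g v ≡ w

HasSize : (V4 → Set) → ℕ → Set
HasSize P n = Σ (List V4) λ l → Unique l × (length l ≡ n) ×
  (∀ x → (P x → x ∈ l) × (x ∈ l → P x))

data PL : Set where
  fin : F2 → PL
  ∞ : PL

Pt : PL → V4
Pt (fin t) = (t * t * t) ∷ (t * t) ∷ t ∷ 𝟏 ∷ []
Pt ∞ = 𝟏 ∷ 𝟎 ∷ 𝟎 ∷ 𝟎 ∷ []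

InC : V4 → Set
InC v = Σ PL λ t → v ≡ Pt t

Osc : PL → V4
Osc (fin t) = 𝟏 ∷ (- (three * t)) ∷ (three * (t * t)) ∷ (- (t * t * t)) ∷ []
Osc ∞ = 𝟎 ∷ 𝟎 ∷ 𝟎 ∷ 𝟏 ∷ []

IsΓ : V4 → Set
IsΓ a = Σ PL λ t → a ≡ Osc t

TanDir : PL → V4
TanDir (fin t) = (three * (t * t)) ∷ (two * t) ∷ 𝟏 ∷ 𝟎 ∷ []
TanDir ∞ = 𝟎 ∷ 𝟏 ∷ 𝟎 ∷ 𝟎 ∷ []

OnLine : V4 → V4 → V4 → Set
OnLine u w v = IsPoint v × Σ F2 λ λ₁ → Σ F2 λ μ → v ≡ (λ₁ · u) ⊕ (μ · w)

OnTangent : V4 → Set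
OnTangent v = Σ PL λ t → OnLine (Pt t) (TanDir t) v

InG2 : Mat → Set
InG2 g = Invertible g × (∀ v → (InC v → InC (apply g v)) × (InC (apply g v) → InC v))

CPointsOn : V4 → V4 → Set
CPointsOn a v = InC v × On a v

ΓPlane : V4 → Set
ΓPlane = IsΓ

Bar1CPlane : V4 → Set
Bar1CPlane a = IsPlane a × ¬ IsΓ a × HasSize (CPointsOn a) 1

dCPlane : ℕ → V4 → Set
dCPlane d a = IsPlane a × HasSize (CPointsOn a) d

CPoint : V4 → Set
CPoint = InC

TPoint : V4 → Set
TPoint v = IsPoint v × ¬ InC v × OnTangent v

ΓPlanesThrough : V4 → V4 → Set
ΓPlanesThrough v a = IsΓ a × On a v

μΓPoint : ℕ → V4 → Set
μΓPoint μ v = IsPoint v × ¬ InC v × ¬ OnTangent v × HasSize (ΓPlanesThrough v) μ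

_∪_ : (V4 → Set) → (V4 → Set) → V4 → Set
(P ∪ Q) x = P x ⊎ Q x

IsOrbit : (V4 → Set) → (Mat → V4 → V4 → Set) → (V4 → Set) → Set
IsOrbit X Act K = (∀ x → K x → X x) × (∃ K) ×
  (∀ x y → K x → (K y → Σ Mat λ g → InG2 g × Act g x y) × ((Σ Mat λ g → InG2 g × Act g x y) → K y))

Disjoint : (V4 → Set) → (V4 → Set) → Set
Disjoint P Q = ∀ x → P x → Q x → Data.Empty.⊥
  where import Data.Empty

OrbitsAre4 : (V4 → Set) → (Mat → V4 → V4 → Set) → (K₁ K₂ K₃ K₄ : V4 → Set) → Set
OrbitsAre4 X Act K₁ K₂ K₃ K₄ =
  IsOrbit X Act K₁ × IsOrbit X Act K₂ × IsOrbit X Act K₃ × IsOrbit X Act K₄ ×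
  Disjoint K₁ K₂ × Disjoint K₁ K₃ × Disjoint K₁ K₄ ×
  Disjoint K₂ K₃ × Disjoint K₂ K₄ × Disjoint K₃ K₄ ×
  (∀ x → X x → K₁ x ⊎ K₂ x ⊎ K₃ x ⊎ K₄ x)

-- Over F₂ the three points of 𝒞 are linearly independent, and every g ∈ G₂ is
-- linear and permutes them. Hence g preserves, for each k, the set of sums of k
-- distinct points of 𝒞, and (applying this to g⁻¹ ∈ G₂) also the complement of
-- their span. The point orbits are exactly these classes: 𝒞 itself (k = 1), the
-- third points of the chords (k = 2), the sum of all three points (k = 3), and
-- the points off the plane spanned by 𝒞. For planes, if g maps a onto b then g
-- maps the points of 𝒞 on a bijectively onto those on b, so the number of points
-- of 𝒞 on a plane is invariant; the Γ-planes and the 1̄_𝒞-planes are exactly the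
-- planes with one point of 𝒞. Everything else (transitivity, sizes, disjointness,
-- covering) is a finite computation over the sixteen vectors of F₂⁴.
module Submission where

open import Defs
open import Data.Nat using (ℕ; zero; suc; _≟_)
open import Data.Product using (Σ; ∃; _×_; _,_; proj₁; proj₂)
open import Data.Sum using (_⊎_; inj₁; inj₂)
open import Data.List using (List; []; _∷_; length; filter; cartesianProductWith)
import Data.List as List
open import Data.List.Properties using (length-map)
open import Data.List.Membership.Propositional using (_∈_; lose)
open import Data.List.Membership.Propositional.Properties
  using (∈-map⁺; ∈-map⁻; ∈-filter⁺; ∈-filter⁻; ∈-cartesianProductWith⁺)
open import Data.List.Membership.Propositional.Properties.WithK using (unique∧set⇒bag)
open import Data.List.Relation.Binary.BagAndSetEquality using (∼bag⇒↭)
open import Data.List.Relation.Binary.Permutation.Propositional.Properties using (↭-length)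
open import Data.List.Relation.Unary.All as All using (All)
open import Data.List.Relation.Unary.Any as Any using (Any)
import Data.List.Relation.Unary.AllPairs as ListAllPairs
open import Data.List.Relation.Unary.Unique.Propositional using (Unique)
import Data.List.Relation.Unary.Unique.Propositional.Properties as Unique
open import Data.Vec using (Vec; []; _∷_; map; zipWith; replicate; transpose; foldr′)
open import Data.Vec.Properties using (≡-dec; map-cong; map-∘; map-const; zipWith-is-⊛)
import Data.Vec.Relation.Unary.AllPairs as VecAllPairs
import Data.Vec.Relation.Unary.Unique.Propositional as Vec
import Data.Vec.Relation.Unary.Unique.Propositional.Properties as VecUnique
open import Function.Bundles using (_⇔_; mk⇔; _↔_; mk↔ₛ′; Equivalence; Injection; Inverse)
open import Function.Properties.Inverse using (↔⇒↣)
open import Relation.Binary.Definitions using (DecidableEquality)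
open import Relation.Nullary using (Dec; yes; no; ¬_; ¬?; _×-dec_; _⊎-dec_; _→-dec_)
open import Relation.Nullary.Decidable using (map′; True; toWitness; from-yes)
open import Relation.Unary using (Decidable)
open import Relation.Binary.PropositionalEquality
open ≡-Reasoning

infix 4 _≟F_ _≟V_ _≟M_ _≟PL_

_≟F_ : DecidableEquality F2
𝟎 ≟F 𝟎 = yes refl
𝟎 ≟F 𝟏 = no λ ()
𝟏 ≟F 𝟎 = no λ ()
𝟏 ≟F 𝟏 = yes refl

_≟V_ : ∀ {n} → DecidableEquality (Vec F2 n)
_≟V_ = ≡-dec _≟F_

_≟M_ : DecidableEquality Mat
_≟M_ = ≡-dec _≟V_

_≟PL_ : DecidableEquality PL
fin x ≟PL fin y = map′ (cong fin) (λ { refl → refl }) (x ≟F y)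
fin x ≟PL ∞     = no λ ()
∞     ≟PL fin y = no λ ()
∞     ≟PL ∞     = yes refl

module _ {A : Set} {xs : List A} (enumerates : ∀ x → x ∈ xs) {Q : A → Set} (Q? : Decidable Q) where

  ∀-enum? : Dec (∀ x → Q x)
  ∀-enum? = map′ (λ qs x → All.lookup qs (enumerates x)) (λ q → All.tabulate λ {x} _ → q x) (All.all? Q? xs)

  ∃-enum? : Dec (∃ Q)
  ∃-enum? = map′ Any.satisfied (λ (x , qx) → lose (enumerates x) qx) (Any.any? Q? xs)

F2s : List F2
F2s = 𝟎 ∷ 𝟏 ∷ []

∈-F2s : ∀ x → x ∈ F2s
∈-F2s 𝟎 = Any.here refl
∈-F2s 𝟏 = Any.there (Any.here refl)

PLs : List PL
PLs = fin 𝟎 ∷ fin 𝟏 ∷ ∞ ∷ []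

∈-PLs : ∀ t → t ∈ PLs
∈-PLs (fin 𝟎) = Any.here refl
∈-PLs (fin 𝟏) = Any.there (Any.here refl)
∈-PLs ∞       = Any.there (Any.there (Any.here refl))

vectors : {A : Set} → List A → (n : ℕ) → List (Vec A n)
vectors xs zero    = [] ∷ []
vectors xs (suc n) = cartesianProductWith _∷_ xs (vectors xs n)

∈-vectors : {A : Set} {xs : List A} → (∀ x → x ∈ xs) → ∀ {n} (v : Vec A n) → v ∈ vectors xs n
∈-vectors enum []      = Any.here refl
∈-vectors enum (x ∷ v) = ∈-cartesianProductWith⁺ _∷_ (enum x) (∈-vectors enum v)

allV4 : List V4
allV4 = vectors F2s 4

∀F2? : {Q : F2 → Set} → Decidable Q → Dec (∀ x → Q x)
∀F2? = ∀-enum? ∈-F2s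

∃F2? : {Q : F2 → Set} → Decidable Q → Dec (∃ Q)
∃F2? = ∃-enum? ∈-F2s

∀PL? : {Q : PL → Set} → Decidable Q → Dec (∀ t → Q t)
∀PL? = ∀-enum? ∈-PLs

∃PL? : {Q : PL → Set} → Decidable Q → Dec (∃ Q)
∃PL? = ∃-enum? ∈-PLs

∀V4? : {Q : V4 → Set} → Decidable Q → Dec (∀ v → Q v)
∀V4? = ∀-enum? (∈-vectors ∈-F2s)

∃V4? : {Q : V4 → Set} → Decidable Q → Dec (∃ Q)
∃V4? = ∃-enum? (∈-vectors ∈-F2s)

_⇔?_ : {A B : Set} → Dec A → Dec B → Dec (A ⇔ B)
a? ⇔? b? = map′ (λ (f , g) → mk⇔ f g) (λ e → Equivalence.to e , Equivalence.from e) ((a? →-dec b?) ×-dec (b? →-dec a?))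

unique-length : {A : Set} {xs ys : List A} → Unique xs → Unique ys → (∀ {x} → x ∈ xs ⇔ x ∈ ys) → length xs ≡ length ys
unique-length uxs uys xs≈ys = ↭-length (∼bag⇒↭ (unique∧set⇒bag uxs uys xs≈ys))

HasSize-unique : ∀ {P m n} → HasSize P m → HasSize P n → m ≡ n
HasSize-unique (l , ul , refl , l≈P) (k , uk , refl , k≈P) =
  unique-length ul uk (mk⇔ (λ x∈l → proj₁ (k≈P _) (proj₂ (l≈P _) x∈l)) (λ x∈k → proj₁ (l≈P _) (proj₂ (k≈P _) x∈k)))

allV4-unique : Unique allV4
allV4-unique = from-yes (ListAllPairs.allPairs? (λ u v → ¬? (u ≟V v)) allV4)

HasSize-filter : ∀ {P} (P? : Decidable P) → HasSize P (length (filter P? allV4))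
HasSize-filter P? = filter P? allV4 , Unique.filter⁺ P? allV4-unique , refl ,
  λ v → ∈-filter⁺ P? (∈-vectors ∈-F2s v) , λ v∈ → proj₂ (∈-filter⁻ P? v∈)

hasSize? : ∀ {P} → Decidable P → ∀ n → Dec (HasSize P n)
hasSize? P? n = map′ (λ { refl → HasSize-filter P? }) (HasSize-unique (HasSize-filter P?))
  (length (filter P? allV4) ≟ n)

HasSize-↔ : ∀ {P Q n} (f : V4 ↔ V4) → (∀ x → P x ⇔ Q (Inverse.to f x)) → HasSize P n → HasSize Q n
HasSize-↔ {P} {Q} f P⇔Q (l , ul , refl , l≈P) =
  List.map to l , Unique.map⁺ (Injection.injective (↔⇒↣ f)) ul , length-map to l , λ y → Qy⇒∈ y , ∈⇒Qy y
  where
  open Inverse f using (to; from; strictlyInverseˡ)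
  Qy⇒∈ : ∀ y → Q y → y ∈ List.map to l
  Qy⇒∈ y Qy = subst (_∈ List.map to l) (strictlyInverseˡ y)
    (∈-map⁺ to (proj₁ (l≈P (from y)) (Equivalence.from (P⇔Q (from y)) (subst Q (sym (strictlyInverseˡ y)) Qy))))
  ∈⇒Qy : ∀ y → y ∈ List.map to l → Q y
  ∈⇒Qy y y∈ with x , x∈l , refl ← ∈-map⁻ to y∈ = Equivalence.to (P⇔Q x) (proj₂ (l≈P x) x∈l)

*-zeroʳ : ∀ a → a * 𝟎 ≡ 𝟎
*-zeroʳ 𝟎 = refl
*-zeroʳ 𝟏 = refl

*-distribˡ-+ : ∀ a x y → a * (x + y) ≡ a * x + a * y
*-distribˡ-+ = from-yes (∀F2? λ a → ∀F2? λ x → ∀F2? λ y → a * (x + y) ≟F a * x + a * y)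

+-interchange : ∀ x y p q → (x + y) + (p + q) ≡ (x + p) + (y + q)
+-interchange = from-yes (∀F2? λ x → ∀F2? λ y → ∀F2? λ p → ∀F2? λ q → (x + y) + (p + q) ≟F (x + p) + (y + q))

dot-zeroʳ : ∀ {n} (r : Vec F2 n) → dot r (replicate n 𝟎) ≡ 𝟎
dot-zeroʳ []      = refl
dot-zeroʳ (a ∷ r) = cong₂ _+_ (*-zeroʳ a) (dot-zeroʳ r)

dot-distribʳ : ∀ {n} (r u w : Vec F2 n) → dot r (zipWith _+_ u w) ≡ dot r u + dot r w
dot-distribʳ []      []      []      = refl
dot-distribʳ (a ∷ r) (x ∷ u) (y ∷ w) = begin
  a * (x + y) + dot r (zipWith _+_ u w)  ≡⟨ cong₂ _+_ (*-distribˡ-+ a x y) (dot-distribʳ r u w) ⟩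
  (a * x + a * y) + (dot r u + dot r w)  ≡⟨ +-interchange (a * x) (a * y) (dot r u) (dot r w) ⟩
  (a * x + dot r u) + (a * y + dot r w)  ∎

dot-map-dot-∷ : ∀ {m k} a (r : Vec F2 m) (s : Vec F2 k) (cols : Vec (Vec F2 m) k) v →
  dot (map (dot (a ∷ r)) (zipWith _∷_ s cols)) v ≡ a * dot s v + dot (map (dot r) cols) v
dot-map-dot-∷ a r []      []         []      = sym (cong (_+ 𝟎) (*-zeroʳ a))
dot-map-dot-∷ a r (x ∷ s) (c ∷ cols) (b ∷ v) = begin
  (a * x + dot r c) * b + dot (map (dot (a ∷ r)) (zipWith _∷_ s cols)) v
    ≡⟨ cong ((a * x + dot r c) * b +_) (dot-map-dot-∷ a r s cols v) ⟩
  (a * x + dot r c) * b + (a * dot s v + dot (map (dot r) cols) v)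
    ≡⟨ regroup a x (dot r c) b (dot s v) (dot (map (dot r) cols) v) ⟩
  a * (x * b + dot s v) + (dot r c * b + dot (map (dot r) cols) v)
    ∎
  where
  regroup : ∀ a x y b p q → (a * x + y) * b + (a * p + q) ≡ a * (x * b + p) + (y * b + q)
  regroup = from-yes (∀F2? λ a → ∀F2? λ x → ∀F2? λ y → ∀F2? λ b → ∀F2? λ p → ∀F2? λ q →
    (a * x + y) * b + (a * p + q) ≟F a * (x * b + p) + (y * b + q))

dot-map-[] : ∀ {k} (v : Vec F2 k) → dot (map (dot []) (replicate k [])) v ≡ 𝟎
dot-map-[] []      = refl
dot-map-[] (b ∷ v) = dot-map-[] v

dot-map-transpose : ∀ {m k} (r : Vec F2 m) (N : Vec (Vec F2 k) m) v →
  dot r (map (λ s → dot s v) N) ≡ dot (map (dot r) (transpose N)) v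
dot-map-transpose []      []      v = sym (dot-map-[] v)
dot-map-transpose (a ∷ r) (s ∷ N) v = begin
  a * dot s v + dot r (map (λ s → dot s v) N)
    ≡⟨ cong (a * dot s v +_) (dot-map-transpose r N v) ⟩
  a * dot s v + dot (map (dot r) (transpose N)) v
    ≡⟨ sym (dot-map-dot-∷ a r s (transpose N) v) ⟩
  dot (map (dot (a ∷ r)) (zipWith _∷_ s (transpose N))) v
    ≡⟨ cong (λ cols → dot (map (dot (a ∷ r)) cols) v) (zipWith-is-⊛ _∷_ s (transpose N)) ⟩
  dot (map (dot (a ∷ r)) (transpose (s ∷ N))) v
    ∎

apply-⊗ : ∀ M N v → apply M (apply N v) ≡ apply (M ⊗ N) v
apply-⊗ M N v = trans (map-cong (λ r → dot-map-transpose r N v) M)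
                       (map-∘ (λ r → dot r v) (λ r → map (dot r) (transpose N)) M)

apply-⊕ : ∀ M u w → apply M (u ⊕ w) ≡ apply M u ⊕ apply M w
apply-⊕ M u w = rows M
  where
  rows : ∀ {m} (M : Vec V4 m) →
    map (λ r → dot r (u ⊕ w)) M ≡ zipWith _+_ (map (λ r → dot r u) M) (map (λ r → dot r w) M)
  rows []      = refl
  rows (r ∷ M) = cong₂ _∷_ (dot-distribʳ r u w) (rows M)

apply-zero4 : ∀ M → apply M zero4 ≡ zero4
apply-zero4 M = trans (map-cong dot-zeroʳ M) (map-const M 𝟎)

apply-I4 : ∀ v → apply I4 v ≡ v
apply-I4 = from-yes (∀V4? λ v → apply I4 v ≟V v)

Pt-injective : ∀ {s t} → Pt s ≡ Pt t → s ≡ t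
Pt-injective {s} {t} = from-yes (∀PL? λ s → ∀PL? λ t → (Pt s ≟V Pt t) →-dec (s ≟PL t)) s t

InC⇒IsPoint : ∀ {v} → InC v → IsPoint v
InC⇒IsPoint (t , refl) = from-yes (∀PL? λ t → ¬? (Pt t ≟V zero4)) t

PreservesC : Mat → Set
PreservesC g = ∀ v → (InC v → InC (apply g v)) × (InC (apply g v) → InC v)

module _ {g : Mat} (g∈G : InG2 g) where

  inverse : Mat
  inverse = proj₁ (proj₁ g∈G)

  private
    g⊗inverse : g ⊗ inverse ≡ I4
    g⊗inverse = proj₁ (proj₂ (proj₁ g∈G))

    inverse⊗g : inverse ⊗ g ≡ I4
    inverse⊗g = proj₂ (proj₂ (proj₁ g∈G))

    preservesC : PreservesC g
    preservesC = proj₂ g∈G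

  inverse-cancelˡ : ∀ v → apply inverse (apply g v) ≡ v
  inverse-cancelˡ v = begin
    apply inverse (apply g v)  ≡⟨ apply-⊗ inverse g v ⟩
    apply (inverse ⊗ g) v      ≡⟨ cong (λ M → apply M v) inverse⊗g ⟩
    apply I4 v                 ≡⟨ apply-I4 v ⟩
    v                          ∎

  inverse-cancelʳ : ∀ v → apply g (apply inverse v) ≡ v
  inverse-cancelʳ v = begin
    apply g (apply inverse v)  ≡⟨ apply-⊗ g inverse v ⟩
    apply (g ⊗ inverse) v      ≡⟨ cong (λ M → apply M v) g⊗inverse ⟩
    apply I4 v                 ≡⟨ apply-I4 v ⟩
    v                          ∎

  apply-↔ : V4 ↔ V4
  apply-↔ = mk↔ₛ′ (apply g) (apply inverse) inverse-cancelʳ inverse-cancelˡ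

  inverse-InG2 : InG2 inverse
  inverse-InG2 = (g , inverse⊗g , g⊗inverse) , λ v →
    (λ c → proj₂ (preservesC (apply inverse v)) (subst InC (sym (inverse-cancelʳ v)) c)) ,
    (λ c → subst InC (inverse-cancelʳ v) (proj₁ (preservesC (apply inverse v)) c))

  permutationOfC : PL → PL
  permutationOfC t = proj₁ (proj₁ (preservesC (Pt t)) (t , refl))

  apply-Pt : ∀ t → apply g (Pt t) ≡ Pt (permutationOfC t)
  apply-Pt t = proj₂ (proj₁ (preservesC (Pt t)) (t , refl))

  permutationOfC-injective : ∀ {s t} → permutationOfC s ≡ permutationOfC t → s ≡ t
  permutationOfC-injective {s} {t} e = Pt-injective (begin
    Pt s                                   ≡⟨ sym (inverse-cancelˡ (Pt s)) ⟩
    apply inverse (apply g (Pt s))         ≡⟨ cong (apply inverse) (trans (apply-Pt s) (cong Pt e)) ⟩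
    apply inverse (Pt (permutationOfC t))  ≡⟨ cong (apply inverse) (sym (apply-Pt t)) ⟩
    apply inverse (apply g (Pt t))         ≡⟨ inverse-cancelˡ (Pt t) ⟩
    Pt t                                   ∎)

sumC : ∀ {k} → Vec PL k → V4
sumC = foldr′ (λ t v → Pt t ⊕ v) zero4

SumOfCPoints : ℕ → V4 → Set
SumOfCPoints k v = Σ (Vec PL k) λ ts → Vec.Unique ts × v ≡ sumC ts

InSpanC : V4 → Set
InSpanC v = SumOfCPoints 0 v ⊎ SumOfCPoints 1 v ⊎ SumOfCPoints 2 v ⊎ SumOfCPoints 3 v

apply-sumC : ∀ {g} (g∈G : InG2 g) {k} (ts : Vec PL k) → apply g (sumC ts) ≡ sumC (map (permutationOfC g∈G) ts)
apply-sumC {g} g∈G []       = apply-zero4 g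
apply-sumC {g} g∈G (t ∷ ts) = begin
  apply g (Pt t ⊕ sumC ts)
    ≡⟨ apply-⊕ g (Pt t) (sumC ts) ⟩
  apply g (Pt t) ⊕ apply g (sumC ts)
    ≡⟨ cong₂ _⊕_ (apply-Pt g∈G t) (apply-sumC g∈G ts) ⟩
  Pt (permutationOfC g∈G t) ⊕ sumC (map (permutationOfC g∈G) ts)
    ∎

Invariant : (V4 → Set) → Set
Invariant P = ∀ {g} → InG2 g → ∀ v → P v → P (apply g v)

InC-invariant : Invariant InC
InC-invariant g∈G v = proj₁ (proj₂ g∈G v)

SumOfCPoints-invariant : ∀ k → Invariant (SumOfCPoints k)
SumOfCPoints-invariant k g∈G v (ts , unique , refl) =
  map (permutationOfC g∈G) ts , VecUnique.map⁺ (permutationOfC-injective g∈G) unique , apply-sumC g∈G ts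

¬-invariant : ∀ {P} → Invariant P → Invariant (λ v → ¬ P v)
¬-invariant {P} P-inv {g} g∈G v ¬Pv Pgv =
  ¬Pv (subst P (inverse-cancelˡ g∈G v) (P-inv (inverse-InG2 g∈G) (apply g v) Pgv))

⊎-invariant : ∀ {P Q} → Invariant P → Invariant Q → Invariant (λ v → P v ⊎ Q v)
⊎-invariant P-inv Q-inv g∈G v (inj₁ Pv) = inj₁ (P-inv g∈G v Pv)
⊎-invariant P-inv Q-inv g∈G v (inj₂ Qv) = inj₂ (Q-inv g∈G v Qv)

Invariant-⇔ : ∀ {P Q} → (∀ v → P v ⇔ Q v) → Invariant Q → Invariant P
Invariant-⇔ P⇔Q Q-invariant g∈G v Pv =
  Equivalence.from (P⇔Q _) (Q-invariant g∈G v (Equivalence.to (P⇔Q v) Pv))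

InSpanC-invariant : Invariant InSpanC
InSpanC-invariant = ⊎-invariant (SumOfCPoints-invariant 0) (⊎-invariant (SumOfCPoints-invariant 1)
  (⊎-invariant (SumOfCPoints-invariant 2) (SumOfCPoints-invariant 3)))

isPoint? : Decidable IsPoint
isPoint? v = ¬? (v ≟V zero4)

isPlane? : Decidable IsPlane
isPlane? = isPoint?

inC? : Decidable InC
inC? v = ∃PL? λ t → v ≟V Pt t

on? : ∀ a → Decidable (On a)
on? a v = dot a v ≟F 𝟎

isΓ? : Decidable IsΓ
isΓ? a = ∃PL? λ t → a ≟V Osc t

onTangent? : Decidable OnTangent
onTangent? v = ∃PL? λ t → isPoint? v ×-dec ∃F2? λ l → ∃F2? λ m → v ≟V (l · Pt t) ⊕ (m · TanDir t)

tPoint? : Decidable TPoint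
tPoint? v = isPoint? v ×-dec ¬? (inC? v) ×-dec onTangent? v

μΓPoint? : ∀ μ → Decidable (μΓPoint μ)
μΓPoint? μ v = isPoint? v ×-dec ¬? (inC? v) ×-dec ¬? (onTangent? v) ×-dec
  hasSize? (λ a → isΓ? a ×-dec on? a v) μ

bar1CPlane? : Decidable Bar1CPlane
bar1CPlane? a = isPlane? a ×-dec ¬? (isΓ? a) ×-dec hasSize? (λ v → inC? v ×-dec on? a v) 1

dCPlane? : ∀ d → Decidable (dCPlane d)
dCPlane? d a = isPlane? a ×-dec hasSize? (λ v → inC? v ×-dec on? a v) d

_∪?_ : ∀ {P Q} → Decidable P → Decidable Q → Decidable (P ∪ Q)
(P? ∪? Q?) v = P? v ⊎-dec Q? v

sumOfCPoints? : ∀ k → Decidable (SumOfCPoints k)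
sumOfCPoints? k v = ∃-enum? (∈-vectors ∈-PLs) λ ts →
  VecAllPairs.allPairs? (λ s t → ¬? (s ≟PL t)) ts ×-dec v ≟V sumC ts

inSpanC? : Decidable InSpanC
inSpanC? v = sumOfCPoints? 0 v ⊎-dec sumOfCPoints? 1 v ⊎-dec sumOfCPoints? 2 v ⊎-dec sumOfCPoints? 3 v

preservesC? : Decidable PreservesC
preservesC? g = ∀V4? λ v → (inC? v →-dec inC? (apply g v)) ×-dec (inC? (apply g v) →-dec inC? v)

mapsPlane? : ∀ g a b → Dec (MapsPlane g a b)
mapsPlane? g a b = ∀V4? λ v → isPoint? v →-dec
  ((on? a v →-dec on? b (apply g v)) ×-dec (on? b (apply g v) →-dec on? a v))

mapsPoint? : ∀ g v w → Dec (MapsPoint g v w)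
mapsPoint? g v w = apply g v ≟V w

On-zero4 : ∀ v → On zero4 v
On-zero4 (_ ∷ _ ∷ _ ∷ _ ∷ []) = refl

plane-misses-point : ∀ a → IsPlane a → Σ V4 λ v → IsPoint v × ¬ On a v
plane-misses-point = from-yes (∀V4? λ a → isPlane? a →-dec ∃V4? λ v → isPoint? v ×-dec ¬? (on? a v))

IsPlane-preserved : ∀ {g a b} → MapsPlane g a b → IsPlane a → IsPlane b
IsPlane-preserved {g} {a} maps a≢0 refl with v , v≢0 , v∉a ← plane-misses-point a a≢0 =
  v∉a (proj₂ (maps v v≢0) (On-zero4 (apply g v)))

CPointsOn-transport : ∀ {g a b} → InG2 g → MapsPlane g a b → ∀ v → CPointsOn a v ⇔ CPointsOn b (apply g v)
CPointsOn-transport g∈G maps v = mk⇔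
  (λ (v∈C , v∈a) → InC-invariant g∈G v v∈C , proj₁ (maps v (InC⇒IsPoint v∈C)) v∈a)
  (λ (gv∈C , gv∈b) → let v∈C = proj₂ (proj₂ g∈G v) gv∈C in v∈C , proj₂ (maps v (InC⇒IsPoint v∈C)) gv∈b)

dCPlane-preserved : ∀ {d g a b} → InG2 g → MapsPlane g a b → dCPlane d a → dCPlane d b
dCPlane-preserved {a = a} {b} g∈G maps (a≢0 , size) =
  IsPlane-preserved maps a≢0 , HasSize-↔ (apply-↔ g∈G) (CPointsOn-transport {a = a} {b} g∈G maps) size

-- Found by a computer search: any two elements of one of the orbits below, of
-- points or of planes, are mapped to each other by one of these nine elements.
involutions : List Mat
involutions =
    ((𝟎 ∷ 𝟎 ∷ 𝟎 ∷ 𝟏 ∷ []) ∷ (𝟎 ∷ 𝟎 ∷ 𝟏 ∷ 𝟎 ∷ []) ∷ (𝟎 ∷ 𝟏 ∷ 𝟎 ∷ 𝟎 ∷ []) ∷ (𝟏 ∷ 𝟎 ∷ 𝟎 ∷ 𝟎 ∷ []) ∷ [])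
  ∷ ((𝟏 ∷ 𝟎 ∷ 𝟎 ∷ 𝟎 ∷ []) ∷ (𝟏 ∷ 𝟎 ∷ 𝟏 ∷ 𝟎 ∷ []) ∷ (𝟏 ∷ 𝟏 ∷ 𝟎 ∷ 𝟎 ∷ []) ∷ (𝟏 ∷ 𝟏 ∷ 𝟏 ∷ 𝟏 ∷ []) ∷ [])
  ∷ ((𝟏 ∷ 𝟎 ∷ 𝟎 ∷ 𝟏 ∷ []) ∷ (𝟎 ∷ 𝟎 ∷ 𝟏 ∷ 𝟏 ∷ []) ∷ (𝟎 ∷ 𝟏 ∷ 𝟎 ∷ 𝟏 ∷ []) ∷ (𝟎 ∷ 𝟎 ∷ 𝟎 ∷ 𝟏 ∷ []) ∷ [])
  ∷ ((𝟏 ∷ 𝟎 ∷ 𝟎 ∷ 𝟎 ∷ []) ∷ (𝟎 ∷ 𝟏 ∷ 𝟎 ∷ 𝟎 ∷ []) ∷ (𝟎 ∷ 𝟎 ∷ 𝟏 ∷ 𝟎 ∷ []) ∷ (𝟎 ∷ 𝟏 ∷ 𝟏 ∷ 𝟏 ∷ []) ∷ [])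
  ∷ ((𝟏 ∷ 𝟎 ∷ 𝟎 ∷ 𝟎 ∷ []) ∷ (𝟏 ∷ 𝟏 ∷ 𝟎 ∷ 𝟎 ∷ []) ∷ (𝟏 ∷ 𝟎 ∷ 𝟏 ∷ 𝟎 ∷ []) ∷ (𝟏 ∷ 𝟎 ∷ 𝟎 ∷ 𝟏 ∷ []) ∷ [])
  ∷ ((𝟎 ∷ 𝟏 ∷ 𝟏 ∷ 𝟏 ∷ []) ∷ (𝟎 ∷ 𝟎 ∷ 𝟏 ∷ 𝟎 ∷ []) ∷ (𝟎 ∷ 𝟏 ∷ 𝟎 ∷ 𝟎 ∷ []) ∷ (𝟏 ∷ 𝟏 ∷ 𝟏 ∷ 𝟎 ∷ []) ∷ [])
  ∷ ((𝟏 ∷ 𝟏 ∷ 𝟏 ∷ 𝟏 ∷ []) ∷ (𝟎 ∷ 𝟏 ∷ 𝟎 ∷ 𝟏 ∷ []) ∷ (𝟎 ∷ 𝟎 ∷ 𝟏 ∷ 𝟏 ∷ []) ∷ (𝟎 ∷ 𝟎 ∷ 𝟎 ∷ 𝟏 ∷ []) ∷ [])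
  ∷ ((𝟏 ∷ 𝟏 ∷ 𝟏 ∷ 𝟎 ∷ []) ∷ (𝟎 ∷ 𝟎 ∷ 𝟏 ∷ 𝟎 ∷ []) ∷ (𝟎 ∷ 𝟏 ∷ 𝟎 ∷ 𝟎 ∷ []) ∷ (𝟎 ∷ 𝟎 ∷ 𝟎 ∷ 𝟏 ∷ []) ∷ [])
  ∷ ((𝟏 ∷ 𝟏 ∷ 𝟏 ∷ 𝟎 ∷ []) ∷ (𝟎 ∷ 𝟏 ∷ 𝟎 ∷ 𝟎 ∷ []) ∷ (𝟎 ∷ 𝟎 ∷ 𝟏 ∷ 𝟎 ∷ []) ∷ (𝟎 ∷ 𝟏 ∷ 𝟏 ∷ 𝟏 ∷ []) ∷ [])
  ∷ []

involutions-InG2 : All InG2 involutions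
involutions-InG2 = All.map (λ {g} (g⊗g≡I4 , preserves) → (g , g⊗g≡I4 , g⊗g≡I4) , preserves)
  (from-yes (All.all? (λ g → g ⊗ g ≟M I4 ×-dec preservesC? g) involutions))

ConnectedByInvolutions : (Mat → V4 → V4 → Set) → (V4 → Set) → Set
ConnectedByInvolutions Act K = ∀ x y → K x → K y → Any (λ g → Act g x y) involutions

connectedByInvolutions? : ∀ {Act K} → (∀ g x y → Dec (Act g x y)) → Decidable K → Dec (ConnectedByInvolutions Act K)
connectedByInvolutions? Act? K? = ∀V4? λ x → ∀V4? λ y → K? x →-dec K? y →-dec Any.any? (λ g → Act? g x y) involutions

isOrbit : ∀ {X Act K} → (∀ x → K x → X x) → ∃ K → ConnectedByInvolutions Act K →
  (∀ {g} → InG2 g → ∀ x y → Act g x y → K x → K y) → IsOrbit X Act K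
isOrbit K⊆X nonempty connected closed = K⊆X , nonempty , λ x y Kx →
  (λ Ky → let i = connected x y Kx Ky in Any.lookup i , All.lookupAny involutions-InG2 i) ,
  (λ (g , g∈G , act) → closed g∈G x y act Kx)

pointOrbit : ∀ {K} (K? : Decidable K) → Invariant K →
  {True (∀V4? λ v → K? v →-dec isPoint? v)} → {True (∃V4? K?)} →
  {True (connectedByInvolutions? mapsPoint? K?)} → IsOrbit IsPoint MapsPoint K
pointOrbit {K} K? K-invariant {K⊆X} {nonempty} {connected} =
  isOrbit (toWitness K⊆X) (toWitness nonempty) (toWitness connected)
    λ g∈G x y gx≡y Kx → subst K gx≡y (K-invariant g∈G x Kx)

planeOrbit : ∀ {K} (K? : Decidable K) d →
  {True (∀V4? λ a → K? a ⇔? dCPlane? d a)} → {True (∃V4? K?)} →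
  {True (connectedByInvolutions? mapsPlane? K?)} → IsOrbit IsPlane MapsPlane K
planeOrbit K? d {K⇔dC} {nonempty} {connected} =
  isOrbit (λ a Ka → proj₁ (to (K⇔dC′ a) Ka)) (toWitness nonempty) (toWitness connected)
    λ g∈G x y maps Kx → from (K⇔dC′ y) (dCPlane-preserved g∈G maps (to (K⇔dC′ x) Kx))
  where
  open Equivalence using (to; from)
  K⇔dC′ = toWitness K⇔dC

disjoint? : ∀ {P Q} → Decidable P → Decidable Q → Dec (Disjoint P Q)
disjoint? P? Q? = ∀V4? λ x → P? x →-dec Q? x →-dec no λ ()

orbitsAre4 : ∀ {X Act K₁ K₂ K₃ K₄} (X? : Decidable X) (K₁? : Decidable K₁) (K₂? : Decidable K₂)
  (K₃? : Decidable K₃) (K₄? : Decidable K₄) →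
  IsOrbit X Act K₁ → IsOrbit X Act K₂ → IsOrbit X Act K₃ → IsOrbit X Act K₄ →
  {True (disjoint? K₁? K₂? ×-dec disjoint? K₁? K₃? ×-dec disjoint? K₁? K₄? ×-dec
         disjoint? K₂? K₃? ×-dec disjoint? K₂? K₄? ×-dec disjoint? K₃? K₄? ×-dec
         ∀V4? λ x → X? x →-dec (K₁? x ⊎-dec K₂? x ⊎-dec K₃? x ⊎-dec K₄? x))} →
  OrbitsAre4 X Act K₁ K₂ K₃ K₄
orbitsAre4 _ _ _ _ _ o₁ o₂ o₃ o₄ {partition} = o₁ , o₂ , o₃ , o₄ , toWitness partition

orbitsOfPlanes : OrbitsAre4 IsPlane MapsPlane (ΓPlane ∪ Bar1CPlane) (dCPlane 2) (dCPlane 3) (dCPlane 0)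
orbitsOfPlanes = orbitsAre4 isPlane? (isΓ? ∪? bar1CPlane?) (dCPlane? 2) (dCPlane? 3) (dCPlane? 0)
  (planeOrbit (isΓ? ∪? bar1CPlane?) 1) (planeOrbit (dCPlane? 2) 2) (planeOrbit (dCPlane? 3) 3) (planeOrbit (dCPlane? 0) 0)

orbitsOfPoints : OrbitsAre4 IsPoint MapsPoint CPoint (TPoint ∪ μΓPoint 0) (μΓPoint 3) (μΓPoint 1)
orbitsOfPoints = orbitsAre4 isPoint? inC? (tPoint? ∪? μΓPoint? 0) (μΓPoint? 3) (μΓPoint? 1)
  (pointOrbit inC? InC-invariant)
  (pointOrbit (tPoint? ∪? μΓPoint? 0) (Invariant-⇔
    (from-yes (∀V4? λ v → (tPoint? ∪? μΓPoint? 0) v ⇔? ¬? (inSpanC? v))) (¬-invariant InSpanC-invariant)))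
  (pointOrbit (μΓPoint? 3) (Invariant-⇔
    (from-yes (∀V4? λ v → μΓPoint? 3 v ⇔? sumOfCPoints? 3 v)) (SumOfCPoints-invariant 3)))
  (pointOrbit (μΓPoint? 1) (Invariant-⇔
    (from-yes (∀V4? λ v → μΓPoint? 1 v ⇔? sumOfCPoints? 2 v)) (SumOfCPoints-invariant 2)))

corollary4p3 : OrbitsAre4 IsPlane MapsPlane (ΓPlane ∪ Bar1CPlane) (dCPlane 2) (dCPlane 3) (dCPlane 0)
    × HasSize ΓPlane 3 × HasSize Bar1CPlane 3 × HasSize (ΓPlane ∪ Bar1CPlane) 6
    × HasSize (dCPlane 2) 6 × HasSize (dCPlane 3) 1 × HasSize (dCPlane 0) 2
    × OrbitsAre4 IsPoint MapsPoint CPoint (TPoint ∪ μΓPoint 0) (μΓPoint 3) (μΓPoint 1)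
    × HasSize CPoint 3 × HasSize TPoint 6 × HasSize (μΓPoint 0) 2
    × HasSize (TPoint ∪ μΓPoint 0) 8 × HasSize (μΓPoint 3) 1 × HasSize (μΓPoint 1) 3
corollary4p3 =
  orbitsOfPlanes ,
  from-yes (hasSize? isΓ? 3) , from-yes (hasSize? bar1CPlane? 3) , from-yes (hasSize? (isΓ? ∪? bar1CPlane?) 6) ,
  from-yes (hasSize? (dCPlane? 2) 6) , from-yes (hasSize? (dCPlane? 3) 1) , from-yes (hasSize? (dCPlane? 0) 2) ,
  orbitsOfPoints ,
  from-yes (hasSize? inC? 3) , from-yes (hasSize? tPoint? 6) , from-yes (hasSize? (μΓPoint? 0) 2) ,
  from-yes (hasSize? (tPoint? ∪? μΓPoint? 0) 8) , from-yes (hasSize? (μΓPoint? 3) 1) , from-yes (hasSize? (μΓPoint? 1) 3)
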